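{- Let $\pi$ be a permutation that has opposing adjacencies, i.e. $\pi$ contains at least one up-adjacency and at least one down-adjacency. Then $\mu[1,\pi]=0$.
   Context: Permutations are ordered by containment: $\sigma\le\pi$ if $\pi$ has a subsequence order-isomorphic to $\sigma$. For permutations $\sigma,\pi$, $[\sigma,\pi]=\{\tau:\sigma\le\tau\le\pi\}$ and $[\sigma,\pi)=\{\tau:\sigma\le\tau<\pi\}$. The Möbius function is defined by $\mu[\sigma,\pi]=0$ if $\sigma\not\le\pi$, $\mu[\sigma,\pi]=1$ if $\sigma=\pi$, and $\mu[\sigma,\pi]=-\sum_{\tau\in[\sigma,\pi)}\mu[\sigma,\tau]$ otherwise; $1$ denotes the permutation of length one. An interval of a permutation $\pi=\pi_1\cdots\pi_n$ is a non-empty set of contiguous positions $i,i+1,\dots,j$ such that the set of values $\{\pi_i,\dots,\pi_j\}$ is also a set of consecutive integers. An adjacency is an interval of length two; it is an up-adjacency if $\pi_{i}<\pi_{i+1}$ and a down-adjacency otherwise. -}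

module Defs where

open import Data.Nat as ℕ using (ℕ; zero; suc; _<ᵇ_)
open import Data.Nat.Properties using () renaming (_≟_ to _≟ℕ_)
open import Data.Integer as ℤ using (ℤ)
open import Data.Bool using (Bool; true; false; if_then_else_)
open import Data.List using (List; []; _∷_; _++_; map; length; upTo; filter; deduplicate; concatMap; foldr; filterᵇ)
open import Data.List.Properties using (≡-dec)
open import Data.List.Relation.Binary.Permutation.Propositional using (_↭_)
open import Data.List.Relation.Unary.Any using (Any)
open import Data.List.Relation.Unary.Any using (any?)
open import Data.Product using (∃; _×_; _,_)
open import Relation.Binary.PropositionalEquality using (_≡_)
open import Relation.Nullary using (Dec; yes; no; ¬?; does)

-- Permutations are lists of natural numbers, in one-line notation, with
-- values 1..n.
IsPerm : List ℕ → Set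
IsPerm π = π ↭ map suc (upTo (length π))

_≟L_ : (xs ys : List ℕ) → Dec (xs ≡ ys)
_≟L_ = ≡-dec _≟ℕ_

-- all subsequences of a list (as lists, possibly with repetitions)
subsequences : List ℕ → List (List ℕ)
subsequences [] = [] ∷ []
subsequences (x ∷ xs) = let r = subsequences xs in map (x ∷_) r ++ r

countBelow : ℕ → List ℕ → ℕ
countBelow x [] = 0
countBelow x (y ∷ ys) = if y <ᵇ x then suc (countBelow x ys) else countBelow x ys

-- standardisation: the unique permutation of 1..|s| order-isomorphic to a
-- sequence s of distinct numbers
std : List ℕ → List ℕ
std s = map (λ x → suc (countBelow x s)) s

_≼_ : List ℕ → List ℕ → Set
σ ≼ π = Any (λ s → std s ≡ σ) (subsequences π)

_≼?_ : (σ π : List ℕ) → Dec (σ ≼ π)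
σ ≼? π = any? (λ s → std s ≟L σ) (subsequences π)

properPatterns : List ℕ → List (List ℕ)
properPatterns π =
  filter (λ τ → ¬? (τ ≟L π)) (deduplicate _≟L_ (map std (subsequences π)))

sumℤ : List ℤ → ℤ
sumℤ = foldr ℤ._+_ ℤ.0ℤ

-- Möbius function, by the defining recursion
--   μ[σ,π] = 0 if σ ≰ π,  1 if σ = π,  - Σ_{τ ∈ [σ,π)} μ[σ,τ] otherwise.
-- The first argument is fuel (recursion depth); it is set to |π| below,
-- which is always sufficient since every τ < π is shorter than π.
μ′ : ℕ → List ℕ → List ℕ → ℤ
μ′ fuel σ π with σ ≟L π
... | yes _ = ℤ.1ℤ
... | no _ with σ ≼? π
...   | no _ = ℤ.0ℤ
...   | yes _ with fuel
...     | zero = ℤ.0ℤ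
...     | suc f = ℤ.- sumℤ (map (μ′ f σ)
                     (filter (λ τ → σ ≼? τ) (properPatterns π)))

μ : List ℕ → List ℕ → ℤ
μ σ π = μ′ (length π) σ π

HasUpAdjacency : List ℕ → Set
HasUpAdjacency π = ∃ λ pre → ∃ λ post → ∃ λ a → π ≡ pre ++ a ∷ suc a ∷ post

HasDownAdjacency : List ℕ → Set
HasDownAdjacency π = ∃ λ pre → ∃ λ post → ∃ λ a → π ≡ pre ++ suc a ∷ a ∷ post

module Submission where

-- Put α = π - (a+1), β = π - b and γ = α - b.
-- Deleting either of two adjacent values gives the same pattern, so a pattern
-- τ of π not contained in α has an occurrence using both a and a+1 side by
-- side, hence has an up-adjacency; symmetrically for β and the
-- down-adjacency, and a pattern contained in α and β but not in γ has both.
-- By induction μ[1,τ] = 0 for all these τ, and inclusion–exclusion gives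
--   Σ_{τ ∈ [1,π)} μ[1,τ] = Σ_{[1,α]} μ[1,-] + Σ_{[1,β]} μ[1,-] - Σ_{[1,γ]} μ[1,-],
-- where each sum on the right vanishes by the defining recursion of μ.

open import Defs
open import Data.Nat using (ℕ)
open import Data.Integer using (0ℤ)
open import Data.List using (List; _∷_; [])
open import Relation.Binary.PropositionalEquality using (_≡_)

open import Data.Nat using (zero; suc; _<ᵇ_; _≤_; _<_; z≤n; s≤s; _≟_)
open import Relation.Binary.PropositionalEquality
  using (refl; sym; trans; ≢-sym; setoid; cong; cong₂; subst; _≢_; module ≡-Reasoning)
open import Data.Bool using (true; false; T)
open import Data.Empty using (⊥; ⊥-elim)
open import Data.Integer using (ℤ; -_; _+_; _-_)
import Data.Integer.Properties as ℤₚ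
open import Data.Integer.Solver using (module +-*-Solver)
open import Data.List using (map; length; _++_; filter; deduplicate; upTo)
import Data.List.Properties as Listₚ
open import Data.List.Membership.DecPropositional _≟_ using (_∈?_)
open import Data.List.Membership.Propositional using (_∈_; _∉_; find; lose)
open import Data.List.Membership.Propositional.Properties
  using ( ∈-++⁺ˡ; ∈-++⁺ʳ; ∈-++⁻; ∈-map⁺; ∈-map⁻; ∈-filter⁺; ∈-filter⁻
        ; ∈-deduplicate⁺; ∈-deduplicate⁻; ∈-∃++; ∈-upTo⁻)
open import Data.List.Relation.Binary.Equality.Propositional using (≋⇒≡)
open import Data.List.Relation.Binary.Permutation.Propositional as Perm using (_↭_; ↭-sym; ↭⇒↭ₛ)
open import Data.List.Relation.Binary.Permutation.Propositional.Properties using (∈-resp-↭)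
open import Data.List.Relation.Binary.Permutation.Setoid.Properties (setoid ℕ) using (Unique-resp-↭)
open import Data.List.Relation.Binary.Sublist.Propositional
  using (_⊆_; []; _∷_; _∷ʳ_; ⊆-refl; ⊆-trans; lookup; minimum)
open import Data.List.Relation.Binary.Sublist.Propositional.Properties
  using (length-mono-≤; to-≋; map⁺; All-resp-⊆; filter-⊆; filter⁺; ++⁺)
import Data.List.Relation.Unary.All as All
open import Data.List.Relation.Unary.All.Properties using (All¬⇒¬Any)
open import Data.List.Relation.Unary.AllPairs using ([]; _∷_)
import Data.List.Relation.Unary.Any as Any
open import Data.List.Relation.Unary.Any using (here; there)
open import Data.List.Relation.Unary.Unique.Propositional using (Unique)
open import Data.List.Relation.Unary.Unique.Propositional.Properties
  using (Unique[x∷xs]⇒x∉xs; upTo⁺) renaming (filter⁺ to Unique-filter; map⁺ to Unique-map⁺)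
open import Data.List.Relation.Unary.Unique.DecPropositional.Properties using (deduplicate-!)
import Data.Nat.Properties as ℕₚ
open import Data.Product using (∃; ∃₂; _×_; _,_; proj₁; proj₂)
open import Data.Sum using (_⊎_; inj₁; inj₂)
open import Data.Unit using (tt)
open import Function using (_∘_; id)
open import Relation.Binary using (tri<; tri≈; tri>)
open import Relation.Nullary using (¬_; ¬?; Dec; yes; no)
open import Relation.Nullary.Decidable using (decidable-stable; _×-dec_)
open import Relation.Unary using (Decidable)

<ᵇ-true⇒< : ∀ {m n} → (m <ᵇ n) ≡ true → m < n
<ᵇ-true⇒< {m} {n} e = ℕₚ.<ᵇ⇒< m n (subst T (sym e) tt)

<ᵇ-false⇒≥ : ∀ {m n} → (m <ᵇ n) ≡ false → n ≤ m
<ᵇ-false⇒≥ e = ℕₚ.≮⇒≥ (λ m<n → subst T e (ℕₚ.<⇒<ᵇ m<n))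

<⇒<ᵇ-true : ∀ {m n} → m < n → (m <ᵇ n) ≡ true
<⇒<ᵇ-true {m} {n} m<n with m <ᵇ n in e
... | true  = refl
... | false = ⊥-elim (ℕₚ.<⇒≱ m<n (<ᵇ-false⇒≥ e))

≥⇒<ᵇ-false : ∀ {m n} → n ≤ m → (m <ᵇ n) ≡ false
≥⇒<ᵇ-false {m} {n} n≤m with m <ᵇ n in e
... | false = refl
... | true  = ⊥-elim (ℕₚ.<⇒≱ (<ᵇ-true⇒< e) n≤m)

∈-subsequences⁻ : ∀ π {s} → s ∈ subsequences π → s ⊆ π
∈-subsequences⁻ [] (here refl) = []
∈-subsequences⁻ (x ∷ xs) s∈ with ∈-++⁻ (map (x ∷_) (subsequences xs)) s∈
... | inj₂ s∈′ = x ∷ʳ ∈-subsequences⁻ xs s∈′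
... | inj₁ s∈′ with ∈-map⁻ (x ∷_) s∈′
...   | t , t∈ , refl = refl ∷ ∈-subsequences⁻ xs t∈

∈-subsequences⁺ : ∀ {s π} → s ⊆ π → s ∈ subsequences π
∈-subsequences⁺ [] = here refl
∈-subsequences⁺ {π = x ∷ xs} (.x ∷ʳ p) =
  ∈-++⁺ʳ (map (x ∷_) (subsequences xs)) (∈-subsequences⁺ p)
∈-subsequences⁺ {π = x ∷ xs} (refl ∷ p) = ∈-++⁺ˡ (∈-map⁺ (x ∷_) (∈-subsequences⁺ p))

⊆-map-preimage : ∀ {A B : Set} (f : A → B) {s} ys → s ⊆ map f ys → ∃ λ t → t ⊆ ys × map f t ≡ s
⊆-map-preimage f [] [] = [] , [] , refl
⊆-map-preimage f (y ∷ ys) (_ ∷ʳ p) with ⊆-map-preimage f ys p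
... | t , t⊆ , refl = t , y ∷ʳ t⊆ , refl
⊆-map-preimage f (y ∷ ys) (refl ∷ p) with ⊆-map-preimage f ys p
... | t , t⊆ , refl = y ∷ t , refl ∷ t⊆ , refl

⊆-length-≡ : ∀ {A : Set} {xs ys : List A} → xs ⊆ ys → length xs ≡ length ys → xs ≡ ys
⊆-length-≡ p e = ≋⇒≡ (to-≋ e p)

Occurs : List ℕ → List ℕ → Set
Occurs τ π = ∃ λ s → s ⊆ π × std s ≡ τ

≼⇒Occurs : ∀ {τ} π → τ ≼ π → Occurs τ π
≼⇒Occurs π τ≼π with find τ≼π
... | s , s∈ , e = s , ∈-subsequences⁻ π s∈ , e

Occurs⇒≼ : ∀ {τ π} → Occurs τ π → τ ≼ π
Occurs⇒≼ (s , s⊆π , e) = lose (∈-subsequences⁺ s⊆π) e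

Occurs-length : ∀ {τ π} → Occurs τ π → length τ ≤ length π
Occurs-length {π = π} (s , s⊆π , refl) =
  subst (_≤ length π) (sym (Listₚ.length-map _ s)) (length-mono-≤ s⊆π)

Occurs-⊆ : ∀ {τ g h} → Occurs τ g → g ⊆ h → Occurs τ h
Occurs-⊆ (s , s⊆g , e) g⊆h = s , ⊆-trans s⊆g g⊆h , e

rank : List ℕ → ℕ → ℕ
rank s x = suc (countBelow x s)

countBelow-mono : ∀ {x y} s → x ≤ y → countBelow x s ≤ countBelow y s
countBelow-mono [] x≤y = z≤n
countBelow-mono {x} {y} (z ∷ s) x≤y with z <ᵇ x in e₁ | z <ᵇ y in e₂
... | true  | true  = s≤s (countBelow-mono s x≤y)
... | false | false = countBelow-mono s x≤y
... | false | true  = ℕₚ.m≤n⇒m≤1+n (countBelow-mono s x≤y)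
... | true  | false = ⊥-elim (ℕₚ.<⇒≱ (ℕₚ.<-≤-trans (<ᵇ-true⇒< e₁) x≤y) (<ᵇ-false⇒≥ e₂))

countBelow-strict : ∀ {x y} s → y ∈ s → y < x → countBelow y s < countBelow x s
countBelow-strict {x} {y} (z ∷ s) (here refl) y<x
  rewrite <⇒<ᵇ-true y<x | ≥⇒<ᵇ-false (ℕₚ.≤-refl {y}) = s≤s (countBelow-mono s (ℕₚ.<⇒≤ y<x))
countBelow-strict {x} {y} (z ∷ s) (there y∈s) y<x with z <ᵇ y in e₁ | z <ᵇ x in e₂
... | true  | true  = s≤s (countBelow-strict s y∈s y<x)
... | false | false = countBelow-strict s y∈s y<x
... | false | true  = ℕₚ.m≤n⇒m≤1+n (countBelow-strict s y∈s y<x)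
... | true  | false = ⊥-elim (ℕₚ.<⇒≱ (ℕₚ.<-trans (<ᵇ-true⇒< e₁) y<x) (<ᵇ-false⇒≥ e₂))

OrderPreserving : (ℕ → ℕ) → List ℕ → Set
OrderPreserving f s = ∀ {x y} → x ∈ s → y ∈ s → (f y <ᵇ f x) ≡ (y <ᵇ x)

OrderPreserving-⊆ : ∀ f {s t} → s ⊆ t → OrderPreserving f t → OrderPreserving f s
OrderPreserving-⊆ f s⊆t op x∈ y∈ = op (lookup s⊆t x∈) (lookup s⊆t y∈)

rank-preserves-order : ∀ g → OrderPreserving (rank g) g
rank-preserves-order g {x} {y} x∈g y∈g with y <ᵇ x in e
... | true  = <⇒<ᵇ-true (s≤s (countBelow-strict g y∈g (<ᵇ-true⇒< e)))
... | false = ≥⇒<ᵇ-false (s≤s (countBelow-mono g (<ᵇ-false⇒≥ e)))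

countBelow-map : ∀ f x t → (∀ {y} → y ∈ t → (f y <ᵇ f x) ≡ (y <ᵇ x))
  → countBelow (f x) (map f t) ≡ countBelow x t
countBelow-map f x [] _ = refl
countBelow-map f x (y ∷ t) op rewrite op (here refl) with y <ᵇ x
... | true  = cong suc (countBelow-map f x t (op ∘ there))
... | false = countBelow-map f x t (op ∘ there)

std-map : ∀ f s → OrderPreserving f s → std (map f s) ≡ std s
std-map f s op = trans (sym (Listₚ.map-∘ s))
  (Listₚ.map-cong-local (All.tabulate λ {x} x∈s → cong suc (countBelow-map f x s (op x∈s))))

-- Standardisation is idempotent: the ranks are an order-preserving relabelling.
std-idempotent : ∀ g → std (std g) ≡ std g
std-idempotent g = std-map (rank g) g (rank-preserves-order g)

Occurs-std⁻ : ∀ {τ} g → Occurs τ (std g) → Occurs τ g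
Occurs-std⁻ g (s′ , s′⊆ , e) with ⊆-map-preimage (rank g) g s′⊆
... | t , t⊆g , refl =
  t , t⊆g , trans (sym (std-map (rank g) t (OrderPreserving-⊆ (rank g) t⊆g (rank-preserves-order g)))) e

Occurs-std⁺ : ∀ {τ} g → Occurs τ g → Occurs τ (std g)
Occurs-std⁺ g (s , s⊆g , e) =
  map (rank g) s , map⁺ (rank g) s⊆g ,
  trans (std-map (rank g) s (OrderPreserving-⊆ (rank g) s⊆g (rank-preserves-order g))) e

Unique-⊆ : ∀ {A : Set} {s xs : List A} → s ⊆ xs → Unique xs → Unique s
Unique-⊆ [] [] = []
Unique-⊆ (_ ∷ʳ p) (_ ∷ u) = Unique-⊆ p u
Unique-⊆ (refl ∷ p) (x≢xs ∷ u) = All-resp-⊆ p x≢xs ∷ Unique-⊆ p u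

Unique-suffix : ∀ {A : Set} (xs : List A) {ys} → Unique (xs ++ ys) → Unique ys
Unique-suffix [] u = u
Unique-suffix (_ ∷ xs) (_ ∷ u) = Unique-suffix xs u

Unique-disjoint : ∀ {A : Set} (xs : List A) {ys z} → Unique (xs ++ ys) → z ∈ ys → z ∉ xs
Unique-disjoint (x ∷ xs) (x≢ ∷ u) z∈ys (here refl) = All¬⇒¬Any x≢ (∈-++⁺ʳ xs z∈ys)
Unique-disjoint (x ∷ xs) (_ ∷ u) z∈ys (there z∈xs) = Unique-disjoint xs u z∈ys z∈xs

position-unique : ∀ {A : Set} (p₁ p₂ : List A) {x r₁ r₂} → Unique (p₁ ++ x ∷ r₁)
  → p₁ ++ x ∷ r₁ ≡ p₂ ++ x ∷ r₂ → p₁ ≡ p₂ × r₁ ≡ r₂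
position-unique [] [] u refl = refl , refl
position-unique [] (y ∷ p₂) {x} u e with Listₚ.∷-injective e
... | refl , e′ = ⊥-elim (Unique[x∷xs]⇒x∉xs u (subst (x ∈_) (sym e′) (∈-++⁺ʳ p₂ (here refl))))
position-unique (y ∷ p₁) [] u e with Listₚ.∷-injective e
... | refl , _ = ⊥-elim (Unique[x∷xs]⇒x∉xs u (∈-++⁺ʳ p₁ (here refl)))
position-unique (y ∷ p₁) (y′ ∷ p₂) (_ ∷ u) e with Listₚ.∷-injective e
... | refl , e′ with position-unique p₁ p₂ u e′
...   | refl , r = refl , r

Unique-map : ∀ {A B : Set} (f : A → B) {s} → (∀ {x y} → x ∈ s → y ∈ s → f x ≡ f y → x ≡ y)
  → Unique s → Unique (map f s)
Unique-map f inj [] = []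
Unique-map f {x ∷ s} inj (x≢s ∷ u) =
  All.tabulate fx≢ ∷ Unique-map f (λ x∈ y∈ → inj (there x∈) (there y∈)) u
  where
  fx≢ : ∀ {z} → z ∈ map f s → f x ≢ z
  fx≢ z∈ refl with ∈-map⁻ f z∈
  ... | y , y∈s , e with inj (here refl) (there y∈s) e
  ...   | refl = All¬⇒¬Any x≢s y∈s

-- Ranks are injective on the entries, so standardisation keeps entries distinct.
Unique-std : ∀ s → Unique s → Unique (std s)
Unique-std s = Unique-map (rank s) rank-injective
  where
  rank-injective : ∀ {x y} → x ∈ s → y ∈ s → rank s x ≡ rank s y → x ≡ y
  rank-injective {x} {y} x∈ y∈ e with ℕₚ.<-cmp x y
  ... | tri< x<y _ _ = ⊥-elim (ℕₚ.<-irrefl (ℕₚ.suc-injective e) (countBelow-strict s x∈ x<y))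
  ... | tri≈ _ x≡y _ = x≡y
  ... | tri> _ _ y<x = ⊥-elim (ℕₚ.<-irrefl (sym (ℕₚ.suc-injective e)) (countBelow-strict s y∈ y<x))

delete : ℕ → List ℕ → List ℕ
delete v = filter (λ x → ¬? (x ≟ v))

delete-⊆ : ∀ v xs → delete v xs ⊆ xs
delete-⊆ v = filter-⊆ (λ x → ¬? (x ≟ v))

delete-mono : ∀ v {xs ys} → xs ⊆ ys → delete v xs ⊆ delete v ys
delete-mono v = filter⁺ (λ x → ¬? (x ≟ v)) (λ x → ¬? (x ≟ v)) λ { refl p → p }

∉-delete : ∀ v xs → v ∉ delete v xs
∉-delete v xs v∈ = proj₂ (∈-filter⁻ (λ x → ¬? (x ≟ v)) {xs = xs} v∈) refl

∈-delete : ∀ {v x} xs → x ∈ xs → x ≢ v → x ∈ delete v xs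
∈-delete {v} xs = ∈-filter⁺ (λ x → ¬? (x ≟ v))

delete-∉ : ∀ {v} xs → v ∉ xs → delete v xs ≡ xs
delete-∉ {v} xs v∉ = Listₚ.filter-all (λ x → ¬? (x ≟ v)) (All.tabulate λ { x∈ refl → v∉ x∈ })

⊆-delete : ∀ {v s xs} → s ⊆ xs → v ∉ s → s ⊆ delete v xs
⊆-delete {v} {s} {xs} s⊆ v∉s = subst (_⊆ delete v xs) (delete-∉ s v∉s) (delete-mono v s⊆)

delete-shorter : ∀ {v} xs → v ∈ xs → length (delete v xs) < length xs
delete-shorter {v} xs v∈ =
  Listₚ.filter-notAll (λ x → ¬? (x ≟ v)) xs (Any.map (λ { refl ¬v≡v → ¬v≡v refl }) v∈)

delete-++ : ∀ v xs ys → delete v (xs ++ ys) ≡ delete v xs ++ delete v ys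
delete-++ v = Listₚ.filter-++ (λ x → ¬? (x ≟ v))

delete-cons-≡ : ∀ {v} xs → delete v (v ∷ xs) ≡ delete v xs
delete-cons-≡ {v} xs = Listₚ.filter-reject (λ x → ¬? (x ≟ v)) (λ ¬v≡v → ¬v≡v refl)

delete-cons-≢ : ∀ {v x} xs → x ≢ v → delete v (x ∷ xs) ≡ x ∷ delete v xs
delete-cons-≢ {v} xs = Listₚ.filter-accept (λ x → ¬? (x ≟ v))

Adjacent : ℕ → ℕ → Set
Adjacent u v = (v ≡ suc u) ⊎ (u ≡ suc v)

<ᵇ-suc : ∀ {z x} → z ≢ x → (z <ᵇ suc x) ≡ (z <ᵇ x)
<ᵇ-suc {z} {x} z≢x with z <ᵇ x in e
... | true  = <⇒<ᵇ-true {z} {suc x} (ℕₚ.m<n⇒m<1+n (<ᵇ-true⇒< e))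
... | false = ≥⇒<ᵇ-false {z} {suc x} (ℕₚ.≤∧≢⇒< (<ᵇ-false⇒≥ e) (z≢x ∘ sym))

suc-<ᵇ : ∀ {x z} → z ≢ suc x → (suc x <ᵇ z) ≡ (x <ᵇ z)
suc-<ᵇ {x} {z} z≢sx with x <ᵇ z in e
... | true  = <⇒<ᵇ-true {suc x} {z} (ℕₚ.≤∧≢⇒< (<ᵇ-true⇒< e) (z≢sx ∘ sym))
... | false = ≥⇒<ᵇ-false {suc x} {z} (ℕₚ.m≤n⇒m≤1+n (<ᵇ-false⇒≥ e))

countBelow-suc-∉ : ∀ {x} s → x ∉ s → countBelow (suc x) s ≡ countBelow x s
countBelow-suc-∉ [] _ = refl
countBelow-suc-∉ {x} (z ∷ s) x∉ rewrite <ᵇ-suc {z} {x} (λ z≡x → x∉ (here (sym z≡x))) with z <ᵇ x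
... | true  = cong suc (countBelow-suc-∉ s (x∉ ∘ there))
... | false = countBelow-suc-∉ s (x∉ ∘ there)

rank-suc : ∀ {x} s → Unique s → x ∈ s → rank s (suc x) ≡ suc (rank s x)
rank-suc {x} (z ∷ s) (x≢s ∷ _) (here refl)
  rewrite <⇒<ᵇ-true (ℕₚ.≤-refl {suc x}) | ≥⇒<ᵇ-false (ℕₚ.≤-refl {x}) =
  cong (suc ∘ suc) (countBelow-suc-∉ s (All¬⇒¬Any x≢s))
rank-suc {x} (z ∷ s) (z≢s ∷ u) (there x∈s)
  rewrite <ᵇ-suc {z} {x} (λ { refl → All¬⇒¬Any z≢s x∈s }) with z <ᵇ x
... | true  = cong suc (rank-suc s u x∈s)
... | false = rank-suc s u x∈s

std-up-adjacency : ∀ s₁ x s₂ → Unique (s₁ ++ x ∷ suc x ∷ s₂)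
  → HasUpAdjacency (std (s₁ ++ x ∷ suc x ∷ s₂))
std-up-adjacency s₁ x s₂ u =
  map r s₁ , map r s₂ , r x ,
  trans (Listₚ.map-++ r s₁ (x ∷ suc x ∷ s₂))
        (cong (λ z → map r s₁ ++ r x ∷ z ∷ map r s₂) (rank-suc s u (∈-++⁺ʳ s₁ (here refl))))
  where
  s = s₁ ++ x ∷ suc x ∷ s₂
  r = rank s

std-down-adjacency : ∀ s₁ x s₂ → Unique (s₁ ++ suc x ∷ x ∷ s₂)
  → HasDownAdjacency (std (s₁ ++ suc x ∷ x ∷ s₂))
std-down-adjacency s₁ x s₂ u =
  map r s₁ , map r s₂ , r x ,
  trans (Listₚ.map-++ r s₁ (suc x ∷ x ∷ s₂))
        (cong (λ z → map r s₁ ++ z ∷ r x ∷ map r s₂) (rank-suc s u (∈-++⁺ʳ s₁ (there (here refl)))))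
  where
  s = s₁ ++ suc x ∷ x ∷ s₂
  r = rank s

relabel : ℕ → ℕ → ℕ → ℕ
relabel u v z with z ≟ u
... | yes _ = v
... | no _  = z

relabel-≡ : ∀ u v → relabel u v u ≡ v
relabel-≡ u v with u ≟ u
... | yes _ = refl
... | no u≢u = ⊥-elim (u≢u refl)

relabel-≢ : ∀ {u v z} → z ≢ u → relabel u v z ≡ z
relabel-≢ {u} {z = z} z≢u with z ≟ u
... | yes z≡u = ⊥-elim (z≢u z≡u)
... | no _ = refl

adjacent-comparisons : ∀ {u v z} → Adjacent u v → z ≢ u → z ≢ v
  → ((z <ᵇ v) ≡ (z <ᵇ u)) × ((v <ᵇ z) ≡ (u <ᵇ z))
adjacent-comparisons (inj₁ refl) z≢u z≢v = <ᵇ-suc z≢u , suc-<ᵇ z≢v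
adjacent-comparisons (inj₂ refl) z≢u z≢v = sym (<ᵇ-suc z≢v) , sym (suc-<ᵇ z≢u)

relabel-preserves-order : ∀ {u v} S → Adjacent u v → v ∉ S → OrderPreserving (relabel u v) S
relabel-preserves-order {u} {v} S adj v∉S {x} {y} x∈ y∈ = go (x ≟ u) (y ≟ u)
  where
  ≢v : ∀ {z} → z ∈ S → z ≢ v
  ≢v z∈ refl = v∉S z∈
  go : Dec (x ≡ u) → Dec (y ≡ u) → (relabel u v y <ᵇ relabel u v x) ≡ (y <ᵇ x)
  go (yes refl) (yes refl) rewrite relabel-≡ u v | ≥⇒<ᵇ-false (ℕₚ.≤-refl {u}) = ≥⇒<ᵇ-false (ℕₚ.≤-refl {v})
  go (yes refl) (no y≢u) rewrite relabel-≡ u v | relabel-≢ {v = v} y≢u =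
    proj₁ (adjacent-comparisons adj y≢u (≢v y∈))
  go (no x≢u) (yes refl) rewrite relabel-≡ u v | relabel-≢ {v = v} x≢u =
    proj₂ (adjacent-comparisons adj x≢u (≢v x∈))
  go (no x≢u) (no y≢u) rewrite relabel-≢ {v = v} x≢u | relabel-≢ {v = v} y≢u = refl

delete-unique : ∀ pre {u post} → Unique (pre ++ u ∷ post) → delete u (pre ++ u ∷ post) ≡ pre ++ post
delete-unique pre {u} {post} uq = begin
  delete u (pre ++ u ∷ post)          ≡⟨ delete-++ u pre (u ∷ post) ⟩
  delete u pre ++ delete u (u ∷ post) ≡⟨ cong₂ _++_ (delete-∉ pre (Unique-disjoint pre uq (here refl)))
                                                     (delete-cons-≡ post) ⟩
  pre ++ delete u post                ≡⟨ cong (pre ++_) (delete-∉ post (Unique[x∷xs]⇒x∉xs (Unique-suffix pre uq))) ⟩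
  pre ++ post                         ∎
  where open ≡-Reasoning

relabel-∉ : ∀ {u v} xs → u ∉ xs → map (relabel u v) xs ≡ xs
relabel-∉ xs u∉ = trans (Listₚ.map-cong-local (All.tabulate λ z∈ → relabel-≢ λ { refl → u∉ z∈ }))
                        (Listₚ.map-id xs)

-- Deleting either value of a consecutive pair of adjacent values leaves the
-- same pattern: the two remaining lists differ by relabelling u as v.
delete-adjacent : ∀ pre {u v post} → Adjacent u v → Unique (pre ++ u ∷ v ∷ post)
  → std (delete u (pre ++ u ∷ v ∷ post)) ≡ std (delete v (pre ++ u ∷ v ∷ post))
delete-adjacent pre {u} {v} {post} adj uq = begin
  std (delete u g)                         ≡⟨ cong std (delete-unique pre uq) ⟩
  std (pre ++ v ∷ post)                    ≡⟨ cong std (sym relabel-u) ⟩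
  std (map (relabel u v) (pre ++ u ∷ post)) ≡⟨ std-map (relabel u v) _ (relabel-preserves-order _ adj v∉) ⟩
  std (pre ++ u ∷ post)                    ≡⟨ cong std (sym delete-v) ⟩
  std (delete v g)                         ∎
  where
  open ≡-Reasoning
  g = pre ++ u ∷ v ∷ post
  assoc : (pre ++ u ∷ []) ++ v ∷ post ≡ g
  assoc = Listₚ.++-assoc pre (u ∷ []) (v ∷ post)
  delete-v : delete v g ≡ pre ++ u ∷ post
  delete-v = trans (cong (delete v) (sym assoc))
    (trans (delete-unique (pre ++ u ∷ []) (subst Unique (sym assoc) uq)) (Listₚ.++-assoc pre (u ∷ []) post))
  v∉ : v ∉ pre ++ u ∷ post
  v∉ = subst (v ∉_) delete-v (∉-delete v g)
  u∉post : u ∉ post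
  u∉post = Unique[x∷xs]⇒x∉xs (Unique-suffix pre uq) ∘ there
  relabel-u : map (relabel u v) (pre ++ u ∷ post) ≡ pre ++ v ∷ post
  relabel-u = trans (Listₚ.map-++ (relabel u v) pre (u ∷ post))
    (cong₂ _++_ (relabel-∉ pre (Unique-disjoint pre uq (here refl)))
                (cong₂ _∷_ (relabel-≡ u v) (relabel-∉ post u∉post)))

consecutive-in-sublist : ∀ {A : Set} (pre : List A) {x y post s} → Unique (pre ++ x ∷ y ∷ post)
  → s ⊆ pre ++ x ∷ y ∷ post → x ∈ s → y ∈ s → ∃₂ λ s₁ s₂ → s ≡ s₁ ++ x ∷ y ∷ s₂
consecutive-in-sublist (p ∷ pre) (_ ∷ uq) (_ ∷ʳ q) x∈ y∈ = consecutive-in-sublist pre uq q x∈ y∈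
consecutive-in-sublist (p ∷ pre) (p≢ ∷ _) (refl ∷ q) (here refl) _ =
  ⊥-elim (All¬⇒¬Any p≢ (∈-++⁺ʳ pre (here refl)))
consecutive-in-sublist (p ∷ pre) (p≢ ∷ _) (refl ∷ q) (there _) (here refl) =
  ⊥-elim (All¬⇒¬Any p≢ (∈-++⁺ʳ pre (there (here refl))))
consecutive-in-sublist (p ∷ pre) (_ ∷ uq) (refl ∷ q) (there x∈) (there y∈)
  with consecutive-in-sublist pre uq q x∈ y∈
... | s₁ , s₂ , refl = p ∷ s₁ , s₂ , refl
consecutive-in-sublist [] (x≢ ∷ _) (_ ∷ʳ q) x∈ _ = ⊥-elim (All¬⇒¬Any x≢ (lookup q x∈))
consecutive-in-sublist [] (x≢ ∷ _) (refl ∷ (_ ∷ʳ q)) _ (here refl) = ⊥-elim (All.head x≢ refl)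
consecutive-in-sublist [] (_ ∷ y≢ ∷ _) (refl ∷ (_ ∷ʳ q)) _ (there y∈) =
  ⊥-elim (All¬⇒¬Any y≢ (lookup q y∈))
consecutive-in-sublist [] _ (refl ∷ (refl ∷ q)) _ _ = [] , _ , refl

adjacency-in-occurrence : ∀ (pre : List ℕ) {x y post s} → Adjacent x y
  → Unique (pre ++ x ∷ y ∷ post) → s ⊆ pre ++ x ∷ y ∷ post → ¬ Occurs (std s) (delete y (pre ++ x ∷ y ∷ post))
  → ∃₂ λ s₁ s₂ → s ≡ s₁ ++ x ∷ y ∷ s₂
adjacency-in-occurrence pre {x} {y} {post} {s} adj uq s⊆g ¬occ =
  consecutive-in-sublist pre uq s⊆g x∈s y∈s
  where
  g = pre ++ x ∷ y ∷ post
  y∈s : y ∈ s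
  y∈s = decidable-stable (y ∈? s) λ y∉s → ¬occ (s , ⊆-delete s⊆g y∉s , refl)
  x∈s : x ∈ s
  x∈s = decidable-stable (x ∈? s) λ x∉s → ¬occ (Occurs-std⁻ (delete y g)
    (subst (Occurs (std s)) (delete-adjacent pre adj uq)
      (Occurs-std⁺ (delete x g) (s , ⊆-delete s⊆g x∉s , refl))))

up-adjacency-inherited : ∀ {g} pre a post {s} → g ≡ pre ++ a ∷ suc a ∷ post → Unique g → s ⊆ g
  → ¬ Occurs (std s) (delete (suc a) g) → HasUpAdjacency (std s)
up-adjacency-inherited pre a post refl uq s⊆g ¬occ with adjacency-in-occurrence pre (inj₁ refl) uq s⊆g ¬occ
... | s₁ , s₂ , refl = std-up-adjacency s₁ a s₂ (Unique-⊆ s⊆g uq)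

down-adjacency-inherited : ∀ {g} pre b post {s} → g ≡ pre ++ suc b ∷ b ∷ post → Unique g → s ⊆ g
  → ¬ Occurs (std s) (delete b g) → HasDownAdjacency (std s)
down-adjacency-inherited pre b post refl uq s⊆g ¬occ with adjacency-in-occurrence pre (inj₂ refl) uq s⊆g ¬occ
... | s₁ , s₂ , refl = std-down-adjacency s₁ b s₂ (Unique-⊆ s⊆g uq)

Occurs-std : ∀ {τ π} → Occurs τ π → std τ ≡ τ
Occurs-std (s , _ , refl) = std-idempotent s

Occurs-proper-shorter : ∀ {τ σ} → std σ ≡ σ → Occurs τ σ → τ ≢ σ → length τ < length σ
Occurs-proper-shorter {σ = σ} σ-std (s , s⊆σ , refl) τ≢σ with ℕₚ.m≤n⇒m<n∨m≡n (length-mono-≤ s⊆σ)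
... | inj₁ s<σ = subst (_< length σ) (sym (Listₚ.length-map (rank s) s)) s<σ
... | inj₂ s≡σ = ⊥-elim (τ≢σ (trans (cong std (⊆-length-≡ s⊆σ s≡σ)) σ-std))

patterns : List ℕ → List (List ℕ)
patterns σ = deduplicate _≟L_ (map std (subsequences σ))

∈-patterns⁻ : ∀ {τ} σ → τ ∈ patterns σ → Occurs τ σ
∈-patterns⁻ σ τ∈ with ∈-map⁻ std (∈-deduplicate⁻ _≟L_ (map std (subsequences σ)) τ∈)
... | s , s∈ , e = s , ∈-subsequences⁻ σ s∈ , sym e

∈-patterns⁺ : ∀ {τ σ} → Occurs τ σ → τ ∈ patterns σ
∈-patterns⁺ (s , s⊆σ , refl) = ∈-deduplicate⁺ _≟L_ (∈-map⁺ std (∈-subsequences⁺ s⊆σ))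

Unique-patterns : ∀ σ → Unique (patterns σ)
Unique-patterns σ = deduplicate-! _≟L_ (map std (subsequences σ))

∈-properPatterns⁻ : ∀ {τ} σ → τ ∈ properPatterns σ → Occurs τ σ × τ ≢ σ
∈-properPatterns⁻ σ τ∈ with ∈-filter⁻ (λ t → ¬? (t ≟L σ)) τ∈
... | τ∈′ , τ≢σ = ∈-patterns⁻ σ τ∈′ , τ≢σ

∈-properPatterns⁺ : ∀ {τ σ} → Occurs τ σ → τ ≢ σ → τ ∈ properPatterns σ
∈-properPatterns⁺ {σ = σ} occ = ∈-filter⁺ (λ t → ¬? (t ≟L σ)) (∈-patterns⁺ occ)

below : List ℕ → List ℕ → List (List ℕ)
below σ π = filter (σ ≼?_) (properPatterns π)

μ′-fuel : ∀ σ f g τ → std τ ≡ τ → length τ ≤ f → length τ ≤ g → μ′ f σ τ ≡ μ′ g σ τ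
μ′-fuel σ f g τ τ-std τ≤f τ≤g with σ ≟L τ
... | yes _ = refl
... | no σ≢τ with σ ≼? τ
...   | no _ = refl
...   | yes σ≼τ with f | g
...     | zero  | _     = ⊥-elim (ℕₚ.n≮0 (ℕₚ.<-≤-trans (Occurs-proper-shorter τ-std (≼⇒Occurs τ σ≼τ) σ≢τ) τ≤f))
...     | suc _ | zero  = ⊥-elim (ℕₚ.n≮0 (ℕₚ.<-≤-trans (Occurs-proper-shorter τ-std (≼⇒Occurs τ σ≼τ) σ≢τ) τ≤g))
...     | suc f′ | suc g′ = cong -_ (cong sumℤ (Listₚ.map-cong-local (All.tabulate same)))
  where
  same : ∀ {t} → t ∈ below σ τ → μ′ f′ σ t ≡ μ′ g′ σ t
  same t∈ with ∈-properPatterns⁻ τ (proj₁ (∈-filter⁻ (σ ≼?_) t∈))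
  ... | occ , t≢τ = μ′-fuel σ f′ g′ _ (Occurs-std occ)
    (ℕₚ.≤-pred (ℕₚ.≤-trans (Occurs-proper-shorter τ-std occ t≢τ) τ≤f))
    (ℕₚ.≤-pred (ℕₚ.≤-trans (Occurs-proper-shorter τ-std occ t≢τ) τ≤g))

μ-unfold : ∀ σ π → std π ≡ π → σ ≢ π → σ ≼ π → μ σ π ≡ - sumℤ (map (μ σ) (below σ π))
μ-unfold σ [] _ σ≢π σ≼π = ⊥-elim (ℕₚ.n≮0 (Occurs-proper-shorter refl (≼⇒Occurs [] σ≼π) σ≢π))
μ-unfold σ π@(x ∷ xs) π-std σ≢π σ≼π with σ ≟L π
... | yes σ≡π = ⊥-elim (σ≢π σ≡π)
... | no _ with σ ≼? π
...   | no σ⋠π = ⊥-elim (σ⋠π σ≼π)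
...   | yes _ = cong -_ (cong sumℤ (Listₚ.map-cong-local (All.tabulate enough-fuel)))
  where
  enough-fuel : ∀ {t} → t ∈ below σ π → μ′ (length xs) σ t ≡ μ σ t
  enough-fuel t∈ with ∈-properPatterns⁻ π (proj₁ (∈-filter⁻ (σ ≼?_) t∈))
  ... | occ , t≢π = μ′-fuel σ _ _ _ (Occurs-std occ)
    (ℕₚ.≤-pred (Occurs-proper-shorter π-std occ t≢π)) ℕₚ.≤-refl

when : ∀ {P : Set} → Dec P → ℤ → ℤ
when (yes _) x = x
when (no _)  _ = 0ℤ

restrict : ∀ {A : Set} {P : A → Set} → Decidable P → (A → ℤ) → A → ℤ
restrict P? f x = when (P? x) (f x)

when-inclusion-exclusion : ∀ {P A B G : Set} (p : Dec P) (a : Dec A) (b : Dec B) (g : Dec G) x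
  → (A → P) → (B → P) → (G → A × B)
  → (P → ¬ A → ¬ B → x ≡ 0ℤ) → (A → B → ¬ G → x ≡ 0ℤ)
  → when p x ≡ when a x + when b x - when g x
when-inclusion-exclusion (no ¬p) (yes a) _ _ _ A⇒P _ _ _ _ = ⊥-elim (¬p (A⇒P a))
when-inclusion-exclusion (no ¬p) _ (yes b) _ _ _ B⇒P _ _ _ = ⊥-elim (¬p (B⇒P b))
when-inclusion-exclusion (no _) (no _) (no _) (no _) _ _ _ _ _ _ = refl
when-inclusion-exclusion _ (no ¬a) _ (yes g) _ _ _ G⇒A×B _ _ = ⊥-elim (¬a (proj₁ (G⇒A×B g)))
when-inclusion-exclusion _ _ (no ¬b) (yes g) _ _ _ G⇒A×B _ _ = ⊥-elim (¬b (proj₂ (G⇒A×B g)))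
when-inclusion-exclusion (yes _) (yes _) (yes _) (yes _) x _ _ _ _ _ =
  solve 1 (λ x → x := x :+ x :- x) refl x
  where open +-*-Solver
when-inclusion-exclusion (yes _) (yes a) (yes b) (no ¬g) x _ _ _ _ neither
  rewrite neither a b ¬g = refl
when-inclusion-exclusion (yes _) (yes _) (no _) (no _) x _ _ _ _ _ =
  solve 1 (λ x → x := x :+ con 0ℤ :- con 0ℤ) refl x
  where open +-*-Solver
when-inclusion-exclusion (yes _) (no _) (yes _) (no _) x _ _ _ _ _ =
  solve 1 (λ x → x := con 0ℤ :+ x :- con 0ℤ) refl x
  where open +-*-Solver
when-inclusion-exclusion (yes p) (no ¬a) (no ¬b) (no _) x _ _ _ outside _
  rewrite outside p ¬a ¬b = refl

sum-combination : ∀ {A : Set} (U : List A) (f g h k : A → ℤ) → (∀ {x} → x ∈ U → f x ≡ g x + h x - k x)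
  → sumℤ (map f U) ≡ sumℤ (map g U) + sumℤ (map h U) - sumℤ (map k U)
sum-combination [] f g h k _ = refl
sum-combination (x ∷ U) f g h k pointwise
  rewrite pointwise (here refl) | sum-combination U f g h k (pointwise ∘ there) =
  solve 6 (λ a b c A B C → (a :+ b :- c) :+ (A :+ B :- C) := (a :+ A) :+ (b :+ B) :- (c :+ C)) refl
    (g x) (h x) (k x) (sumℤ (map g U)) (sumℤ (map h U)) (sumℤ (map k U))
  where open +-*-Solver

sum-middle : ∀ {A : Set} (f : A → ℤ) L₁ {u L₂} → sumℤ (map f (L₁ ++ u ∷ L₂)) ≡ f u + sumℤ (map f (L₁ ++ L₂))
sum-middle f [] = refl
sum-middle f (y ∷ L₁) {u} {L₂} rewrite sum-middle f L₁ {u} {L₂} =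
  solve 3 (λ y u r → y :+ (u :+ r) := u :+ (y :+ r)) refl (f y) (f u) (sumℤ (map f (L₁ ++ L₂)))
  where open +-*-Solver

Unique-remove : ∀ {A : Set} (L₁ : List A) {u L₂} → Unique (L₁ ++ u ∷ L₂)
  → Unique (L₁ ++ L₂) × u ∉ L₁ ++ L₂
Unique-remove L₁ {u} {L₂} uq = Unique-⊆ (++⁺ ⊆-refl (u ∷ʳ ⊆-refl)) uq , u∉
  where
  u∉ : u ∉ L₁ ++ L₂
  u∉ u∈ with ∈-++⁻ L₁ u∈
  ... | inj₁ u∈L₁ = Unique-disjoint L₁ uq (here refl) u∈L₁
  ... | inj₂ u∈L₂ = Unique[x∷xs]⇒x∉xs (Unique-suffix L₁ uq) u∈L₂

sum-over-subset : ∀ {A : Set} {P : A → Set} (P? : Decidable P) (f : A → ℤ) (L U : List A)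
  → Unique L → Unique U → (∀ {x} → x ∈ L → x ∈ U × P x) → (∀ {x} → x ∈ U → P x → x ∈ L)
  → sumℤ (map f L) ≡ sumℤ (map (restrict P? f) U)
sum-over-subset P? f [] [] _ _ _ _ = refl
sum-over-subset P? f (x ∷ L) [] _ _ L⊆ _ with L⊆ (here refl)
... | () , _
sum-over-subset P? f L (u ∷ U) uqL (u∉U ∷ uqU) L⊆ ⊆L with P? u
... | no ¬pu = trans (sum-over-subset P? f L U uqL uqU L⊆U (λ x∈ → ⊆L (there x∈))) (sym (ℤₚ.+-identityˡ _))
  where
  L⊆U : ∀ {x} → x ∈ L → x ∈ U × _
  L⊆U x∈ with L⊆ x∈
  ... | here refl , px = ⊥-elim (¬pu px)
  ... | there x∈U , px = x∈U , px
... | yes pu with ∈-∃++ (⊆L (here refl) pu)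
...   | L₁ , L₂ , refl with Unique-remove L₁ uqL
...     | uqL′ , u∉L′ =
  trans (sum-middle f L₁) (cong (f u +_) (sum-over-subset P? f (L₁ ++ L₂) U uqL′ uqU L′⊆U U⊆L′))
  where
  L′⊆U : ∀ {x} → x ∈ L₁ ++ L₂ → x ∈ U × _
  L′⊆U x∈ with L⊆ (lookup (++⁺ ⊆-refl (u ∷ʳ ⊆-refl)) x∈)
  ... | here refl , _ = ⊥-elim (u∉L′ x∈)
  ... | there x∈U , px = x∈U , px
  U⊆L′ : ∀ {x} → x ∈ U → _ → x ∈ L₁ ++ L₂
  U⊆L′ {x} x∈U px with ∈-++⁻ L₁ (⊆L (there x∈U) px)
  ... | inj₁ x∈L₁ = ∈-++⁺ˡ x∈L₁
  ... | inj₂ (here refl) = ⊥-elim (All¬⇒¬Any u∉U x∈U)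
  ... | inj₂ (there x∈L₂) = ∈-++⁺ʳ L₁ x∈L₂

Occurs-trans : ∀ {τ σ π} → Occurs τ σ → Occurs σ π → Occurs τ π
Occurs-trans τ-in-σ (s , s⊆π , refl) = Occurs-⊆ (Occurs-std⁻ s τ-in-σ) s⊆π

≼-std⇒Occurs : ∀ {τ} g → τ ≼ std g → Occurs τ g
≼-std⇒Occurs g τ≼ = Occurs-std⁻ g (≼⇒Occurs (std g) τ≼)

Occurs⇒≼-std : ∀ {τ} g → Occurs τ g → τ ≼ std g
Occurs⇒≼-std g occ = Occurs⇒≼ (Occurs-std⁺ g occ)

Unique-pattern : ∀ {τ π} → Occurs τ π → Unique π → Unique τ
Unique-pattern (s , s⊆π , refl) uq = Unique-std s (Unique-⊆ s⊆π uq)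

one : List ℕ
one = 1 ∷ []

μ₁ : List ℕ → ℤ
μ₁ = μ one

std-singleton : ∀ x → std (x ∷ []) ≡ one
std-singleton x rewrite ≥⇒<ᵇ-false (ℕₚ.≤-refl {x}) = refl

one-≼ : ∀ σ → 1 ≤ length σ → one ≼ σ
one-≼ (x ∷ xs) _ = Occurs⇒≼ (x ∷ [] , refl ∷ minimum xs , std-singleton x)

InInterval : List ℕ → List ℕ → Set
InInterval σ τ = one ≼ τ × τ ≼ σ

inInterval? : ∀ σ → Decidable (InInterval σ)
inInterval? σ τ = (one ≼? τ) ×-dec (τ ≼? σ)

InProperInterval : List ℕ → List ℕ → Set
InProperInterval π τ = one ≼ τ × τ ≢ π

inProperInterval? : ∀ π → Decidable (InProperInterval π)
inProperInterval? π τ = (one ≼? τ) ×-dec ¬? (τ ≟L π)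

Unique-below : ∀ σ π → Unique (below σ π)
Unique-below σ π = Unique-filter (σ ≼?_) (Unique-filter (λ t → ¬? (t ≟L π)) (Unique-patterns π))

-- Σ_{τ ∈ [1,σ]} μ[1,τ] = 0 for a standard σ of length at least 2; the sum is
-- written over the patterns of any π containing σ.
interval-sum-vanishes : ∀ π σ → std σ ≡ σ → 2 ≤ length σ → Occurs σ π
  → sumℤ (map (restrict (inInterval? σ) μ₁) (patterns π)) ≡ 0ℤ
interval-sum-vanishes π σ σ-std 2≤σ σ-in-π =
  trans (sym (sum-over-subset (inInterval? σ) μ₁ (σ ∷ below one σ) (patterns π) uq (Unique-patterns π) sound complete))
        (trans (cong (_+ Σ) (μ-unfold one σ σ-std one≢σ (one-≼ σ (ℕₚ.<⇒≤ 2≤σ)))) (ℤₚ.+-inverseˡ Σ))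
  where
  Σ = sumℤ (map μ₁ (below one σ))
  one≢σ : one ≢ σ
  one≢σ refl = ℕₚ.<-irrefl refl 2≤σ
  uq : Unique (σ ∷ below one σ)
  uq = All.tabulate (λ τ∈ → ≢-sym (proj₂ (∈-properPatterns⁻ σ (proj₁ (∈-filter⁻ (one ≼?_) τ∈)))))
       ∷ Unique-below one σ
  sound : ∀ {τ} → τ ∈ σ ∷ below one σ → τ ∈ patterns π × InInterval σ τ
  sound (here refl) = ∈-patterns⁺ σ-in-π , one-≼ σ (ℕₚ.<⇒≤ 2≤σ) , Occurs⇒≼ (σ , ⊆-refl , σ-std)
  sound (there τ∈) with ∈-filter⁻ (one ≼?_) τ∈
  ... | τ∈′ , one≼τ = ∈-patterns⁺ (Occurs-trans τ-in-σ σ-in-π) , one≼τ , Occurs⇒≼ τ-in-σ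
    where τ-in-σ = proj₁ (∈-properPatterns⁻ σ τ∈′)
  complete : ∀ {τ} → τ ∈ patterns π → InInterval σ τ → τ ∈ σ ∷ below one σ
  complete {τ} _ (one≼τ , τ≼σ) with τ ≟L σ
  ... | yes refl = here refl
  ... | no τ≢σ = there (∈-filter⁺ (one ≼?_) (∈-properPatterns⁺ (≼⇒Occurs σ τ≼σ) τ≢σ) one≼τ)

μ₁-unfold : ∀ π → std π ≡ π → 2 ≤ length π → μ₁ π ≡ - sumℤ (map (restrict (inProperInterval? π) μ₁) (patterns π))
μ₁-unfold π π-std 2≤π =
  trans (μ-unfold one π π-std one≢π (one-≼ π (ℕₚ.<⇒≤ 2≤π)))
        (cong -_ (sum-over-subset (inProperInterval? π) μ₁ (below one π) (patterns π)
                   (Unique-below one π) (Unique-patterns π) sound complete))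
  where
  one≢π : one ≢ π
  one≢π refl = ℕₚ.<-irrefl refl 2≤π
  sound : ∀ {τ} → τ ∈ below one π → τ ∈ patterns π × InProperInterval π τ
  sound τ∈ with ∈-filter⁻ (one ≼?_) τ∈
  ... | τ∈′ , one≼τ with ∈-filter⁻ (λ t → ¬? (t ≟L π)) τ∈′
  ...   | τ∈″ , τ≢π = τ∈″ , one≼τ , τ≢π
  complete : ∀ {τ} → τ ∈ patterns π → InProperInterval π τ → τ ∈ below one π
  complete τ∈ (one≼τ , τ≢π) = ∈-filter⁺ (one ≼?_) (∈-filter⁺ (λ t → ¬? (t ≟L π)) τ∈ τ≢π) one≼τ

successor-unique : ∀ {π : List ℕ} p₁ p₂ {x y z r₁ r₂} → Unique π
  → π ≡ p₁ ++ x ∷ y ∷ r₁ → π ≡ p₂ ++ x ∷ z ∷ r₂ → y ≡ z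
successor-unique p₁ p₂ uq refl e with position-unique p₁ p₂ uq e
... | _ , r = proj₁ (Listₚ.∷-injective r)

predecessor-unique : ∀ {π : List ℕ} p₁ p₂ {x y z r₁ r₂} → Unique π
  → π ≡ p₁ ++ x ∷ z ∷ r₁ → π ≡ p₂ ++ y ∷ z ∷ r₂ → x ≡ y
predecessor-unique p₁ p₂ {x} {y} {z} {r₁} {r₂} uq refl e
  with position-unique (p₁ ++ x ∷ []) (p₂ ++ y ∷ []) (subst Unique (sym (assoc p₁)) uq)
         (trans (assoc p₁) (trans e (sym (assoc p₂))))
  where
  assoc : ∀ p {w r} → (p ++ w ∷ []) ++ z ∷ r ≡ p ++ w ∷ z ∷ r
  assoc p {w} {r} = Listₚ.++-assoc p (w ∷ []) (z ∷ r)
... | e′ , _ = Listₚ.∷ʳ-injectiveʳ p₁ p₂ e′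

no-back-and-forth : ∀ {π : List ℕ} p₁ p₂ {x y r₁ r₂} → Unique π
  → π ≡ p₁ ++ x ∷ y ∷ r₁ → π ≡ p₂ ++ y ∷ x ∷ r₂ → ⊥
no-back-and-forth p₁ p₂ {x} {y} {r₁} {r₂} uq refl e
  with position-unique (p₁ ++ x ∷ []) p₂ (subst Unique (sym assoc) uq) (trans assoc e)
  where
  assoc : (p₁ ++ x ∷ []) ++ y ∷ r₁ ≡ p₁ ++ x ∷ y ∷ r₁
  assoc = Listₚ.++-assoc p₁ (x ∷ []) (y ∷ r₁)
... | _ , refl = Unique[x∷xs]⇒x∉xs (Unique-suffix p₁ uq) (there (here refl))

opposing-adjacency-values : ∀ {π : List ℕ} pre a post pre′ b post′ → Unique π
  → π ≡ pre ++ a ∷ suc a ∷ post → π ≡ pre′ ++ suc b ∷ b ∷ post′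
  → a ≢ b × b ≢ suc a × a ≢ suc b
opposing-adjacency-values pre a post pre′ b post′ uq up down =
  (λ { refl → no-back-and-forth pre pre′ uq up down }) ,
  (λ { refl → ℕₚ.<⇒≢ (ℕₚ.m<n⇒m<1+n (ℕₚ.n<1+n a)) (predecessor-unique pre pre′ uq up down) }) ,
  (λ { refl → ℕₚ.<⇒≢ (ℕₚ.m<n⇒m<1+n (ℕₚ.n<1+n b)) (sym (successor-unique pre pre′ uq up down)) })

delete-around : ∀ v pre {x y post} → x ≢ v → y ≢ v
  → delete v (pre ++ x ∷ y ∷ post) ≡ delete v pre ++ x ∷ y ∷ delete v post
delete-around v pre {x} {y} {post} x≢v y≢v = begin
  delete v (pre ++ x ∷ y ∷ post)         ≡⟨ delete-++ v pre (x ∷ y ∷ post) ⟩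
  delete v pre ++ delete v (x ∷ y ∷ post) ≡⟨ cong (delete v pre ++_) (delete-cons-≢ (y ∷ post) x≢v) ⟩
  delete v pre ++ x ∷ delete v (y ∷ post) ≡⟨ cong (λ r → delete v pre ++ x ∷ r) (delete-cons-≢ post y≢v) ⟩
  delete v pre ++ x ∷ y ∷ delete v post   ∎
  where open ≡-Reasoning

length≥2 : ∀ {x y : ℕ} xs → x ∈ xs → y ∈ xs → x ≢ y → 2 ≤ length xs
length≥2 (_ ∷ []) (here refl) (here refl) x≢y = ⊥-elim (x≢y refl)
length≥2 (_ ∷ _ ∷ _) _ _ _ = s≤s (s≤s z≤n)

-- With α = π - (a+1), β = π - b and
-- γ = α - b, every τ ∈ [1,π) lies in [1,α] ∪ [1,β] unless it has opposing
-- adjacencies, and lies in [1,γ] if it lies in both unless it has opposing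
-- adjacencies.  Inclusion–exclusion then writes Σ_{[1,π)} μ[1,-] as
-- Σ_{[1,α]} + Σ_{[1,β]} - Σ_{[1,γ]}, and each of these sums vanishes.
module OpposingAdjacencies
  (π : List ℕ) (π-unique : Unique π) (π-std : std π ≡ π)
  (pre : List ℕ) (a : ℕ) (post : List ℕ) (up : π ≡ pre ++ a ∷ suc a ∷ post)
  (pre′ : List ℕ) (b : ℕ) (post′ : List ℕ) (down : π ≡ pre′ ++ suc b ∷ b ∷ post′)
  (induction : ∀ τ → Occurs τ π → τ ≢ π → HasUpAdjacency τ → HasDownAdjacency τ → μ₁ τ ≡ 0ℤ)
  where

  α β γ : List ℕ
  α = delete (suc a) π
  β = delete b π
  γ = delete b α

  a≢b : a ≢ b
  a≢b = proj₁ (opposing-adjacency-values pre a post pre′ b post′ π-unique up down)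

  b≢1+a : b ≢ suc a
  b≢1+a = proj₁ (proj₂ (opposing-adjacency-values pre a post pre′ b post′ π-unique up down))

  a≢1+b : a ≢ suc b
  a≢1+b = proj₂ (proj₂ (opposing-adjacency-values pre a post pre′ b post′ π-unique up down))

  α⊆π : α ⊆ π
  α⊆π = delete-⊆ (suc a) π

  β⊆π : β ⊆ π
  β⊆π = delete-⊆ b π

  γ⊆α : γ ⊆ α
  γ⊆α = delete-⊆ b α

  γ⊆β : γ ⊆ β
  γ⊆β = delete-mono b α⊆π

  β-a+1⊆γ : delete (suc a) β ⊆ γ
  β-a+1⊆γ = ⊆-delete (delete-mono (suc a) β⊆π) (λ b∈ → ∉-delete b π (lookup (delete-⊆ (suc a) β) b∈))

  α-down : α ≡ delete (suc a) pre′ ++ suc b ∷ b ∷ delete (suc a) post′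
  α-down = trans (cong (delete (suc a)) down)
                 (delete-around (suc a) pre′ (a≢b ∘ sym ∘ ℕₚ.suc-injective) b≢1+a)

  β-up : β ≡ delete b pre ++ a ∷ suc a ∷ delete b post
  β-up = trans (cong (delete b) up) (delete-around b pre a≢b (b≢1+a ∘ sym))

  -- γ still contains a and b+1, so all of γ, α, β, π have length at least 2.
  2≤γ : 2 ≤ length γ
  2≤γ = length≥2 γ (∈-delete α (∈-delete π a∈π (ℕₚ.<⇒≢ (ℕₚ.n<1+n a))) a≢b)
                   (∈-delete α (∈-delete π b+1∈π (a≢b ∘ sym ∘ ℕₚ.suc-injective)) (ℕₚ.<⇒≢ (ℕₚ.n<1+n b) ∘ sym))
                   a≢1+b
    where
    a∈π : a ∈ π
    a∈π = subst (a ∈_) (sym up) (∈-++⁺ʳ pre (here refl))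
    b+1∈π : suc b ∈ π
    b+1∈π = subst (suc b ∈_) (sym down) (∈-++⁺ʳ pre′ (here refl))

  2≤α : 2 ≤ length α
  2≤α = ℕₚ.≤-trans 2≤γ (length-mono-≤ γ⊆α)

  2≤β : 2 ≤ length β
  2≤β = ℕₚ.≤-trans 2≤γ (length-mono-≤ γ⊆β)

  2≤π : 2 ≤ length π
  2≤π = ℕₚ.≤-trans 2≤α (length-mono-≤ α⊆π)

  -- α and β are shorter than π, so π is not among their patterns.
  π-not-in-α : ¬ Occurs π α
  π-not-in-α occ = ℕₚ.<⇒≱ (delete-shorter π (subst (suc a ∈_) (sym up) (∈-++⁺ʳ pre (there (here refl)))))
                          (Occurs-length occ)

  π-not-in-β : ¬ Occurs π β
  π-not-in-β occ = ℕₚ.<⇒≱ (delete-shorter π (subst (b ∈_) (sym down) (∈-++⁺ʳ pre′ (there (here refl)))))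
                          (Occurs-length occ)

  -- The two ways a pattern of π can escape the inclusion–exclusion both
  -- force opposing adjacencies.
  outside-α-and-β : ∀ {τ} → Occurs τ π → ¬ Occurs τ α → ¬ Occurs τ β
    → HasUpAdjacency τ × HasDownAdjacency τ
  outside-α-and-β (s , s⊆π , refl) ¬α ¬β =
    up-adjacency-inherited pre a post up π-unique s⊆π ¬α ,
    down-adjacency-inherited pre′ b post′ down π-unique s⊆π ¬β

  inside-α-and-β-not-γ : ∀ {τ} → Occurs τ α → Occurs τ β → ¬ Occurs τ γ
    → HasUpAdjacency τ × HasDownAdjacency τ
  inside-α-and-β-not-γ (s , s⊆α , refl) (s′ , s′⊆β , s′≡) ¬γ =
    subst HasUpAdjacency s′≡
      (up-adjacency-inherited (delete b pre) a (delete b post) β-up (Unique-⊆ β⊆π π-unique) s′⊆β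
        (λ occ → ¬γ (Occurs-⊆ (subst (λ t → Occurs t (delete (suc a) β)) s′≡ occ) β-a+1⊆γ))) ,
    down-adjacency-inherited (delete (suc a) pre′) b (delete (suc a) post′) α-down
      (Unique-⊆ α⊆π π-unique) s⊆α ¬γ

  pointwise : ∀ {τ} → τ ∈ patterns π
    → restrict (inProperInterval? π) μ₁ τ
      ≡ restrict (inInterval? (std α)) μ₁ τ + restrict (inInterval? (std β)) μ₁ τ
        - restrict (inInterval? (std γ)) μ₁ τ
  pointwise {τ} τ∈ =
    when-inclusion-exclusion (inProperInterval? π τ) (inInterval? (std α) τ) (inInterval? (std β) τ)
      (inInterval? (std γ) τ) (μ₁ τ) (proper α π-not-in-α) (proper β π-not-in-β)
      (λ { (one≼τ , τ≼γ) → interval one≼τ α (Occurs-⊆ (≼-std⇒Occurs γ τ≼γ) γ⊆α) ,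
                           interval one≼τ β (Occurs-⊆ (≼-std⇒Occurs γ τ≼γ) γ⊆β) })
      (λ { (one≼τ , τ≢π) ¬A ¬B →
           opposing τ≢π (outside-α-and-β τ-in-π (¬A ∘ interval one≼τ α) (¬B ∘ interval one≼τ β)) })
      (λ { A@(one≼τ , τ≼α) (_ , τ≼β) ¬G →
           opposing (proj₂ (proper α π-not-in-α A))
             (inside-α-and-β-not-γ (≼-std⇒Occurs α τ≼α) (≼-std⇒Occurs β τ≼β) (¬G ∘ interval one≼τ γ)) })
    where
    τ-in-π : Occurs τ π
    τ-in-π = ∈-patterns⁻ π τ∈
    interval : one ≼ τ → ∀ g → Occurs τ g → InInterval (std g) τ
    interval one≼τ g occ = one≼τ , Occurs⇒≼-std g occ
    proper : ∀ g → ¬ Occurs π g → InInterval (std g) τ → InProperInterval π τ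
    proper g π∉g (one≼τ , τ≼g) = one≼τ , λ τ≡π → π∉g (≼-std⇒Occurs g (subst (_≼ std g) τ≡π τ≼g))
    opposing : τ ≢ π → HasUpAdjacency τ × HasDownAdjacency τ → μ₁ τ ≡ 0ℤ
    opposing τ≢π (τ-up , τ-down) = induction τ τ-in-π τ≢π τ-up τ-down

  μ₁-vanishes : μ₁ π ≡ 0ℤ
  μ₁-vanishes = begin
    μ₁ π                          ≡⟨ μ₁-unfold π π-std 2≤π ⟩
    - Σ (inProperInterval? π)     ≡⟨ cong -_ (sum-combination (patterns π) _ _ _ _ pointwise) ⟩
    - (Σ (inInterval? (std α)) + Σ (inInterval? (std β)) - Σ (inInterval? (std γ)))
                                  ≡⟨ cong -_ (cong₂ _-_ (cong₂ _+_ (vanishes α α⊆π 2≤α) (vanishes β β⊆π 2≤β))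
                                                        (vanishes γ (⊆-trans γ⊆α α⊆π) 2≤γ)) ⟩
    - (0ℤ + 0ℤ - 0ℤ)              ≡⟨⟩
    0ℤ                            ∎
    where
    open ≡-Reasoning
    Σ : ∀ {P : List ℕ → Set} → Decidable P → ℤ
    Σ P? = sumℤ (map (restrict P? μ₁) (patterns π))
    vanishes : ∀ g → g ⊆ π → 2 ≤ length g → Σ (inInterval? (std g)) ≡ 0ℤ
    vanishes g g⊆π 2≤g = interval-sum-vanishes π (std g) (std-idempotent g)
      (subst (2 ≤_) (sym (Listₚ.length-map (rank g) g)) 2≤g) (g , g⊆π , refl)

μ₁-opposing-adjacencies : ∀ n π → length π < n → Unique π → std π ≡ π
  → HasUpAdjacency π → HasDownAdjacency π → μ₁ π ≡ 0ℤ
μ₁-opposing-adjacencies (suc n) π π<n π-unique π-std (pre , post , a , up) (pre′ , post′ , b , down) =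
  OpposingAdjacencies.μ₁-vanishes π π-unique π-std pre a post up pre′ b post′ down induction
  where
  induction : ∀ τ → Occurs τ π → τ ≢ π → HasUpAdjacency τ → HasDownAdjacency τ → μ₁ τ ≡ 0ℤ
  induction τ τ-in-π τ≢π =
    μ₁-opposing-adjacencies n τ (ℕₚ.<-≤-trans (Occurs-proper-shorter π-std τ-in-π τ≢π) (ℕₚ.≤-pred π<n))
      (Unique-pattern τ-in-π π-unique) (Occurs-std τ-in-π)

-- A permutation of 1..n has no repetitions and is standard: the entry k+1
-- has exactly k entries below it.
Unique-perm : ∀ {π} → IsPerm π → Unique π
Unique-perm {π} perm =
  Unique-resp-↭ (↭⇒↭ₛ (↭-sym perm)) (Unique-map⁺ ℕₚ.suc-injective (upTo⁺ (length π)))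

countBelow-↭ : ∀ x {xs ys} → xs ↭ ys → countBelow x xs ≡ countBelow x ys
countBelow-↭ x Perm.refl = refl
countBelow-↭ x (Perm.prep y p) with y <ᵇ x
... | true  = cong suc (countBelow-↭ x p)
... | false = countBelow-↭ x p
countBelow-↭ x (Perm.swap y z p) with y <ᵇ x | z <ᵇ x
... | true  | true  = cong (suc ∘ suc) (countBelow-↭ x p)
... | true  | false = cong suc (countBelow-↭ x p)
... | false | true  = cong suc (countBelow-↭ x p)
... | false | false = countBelow-↭ x p
countBelow-↭ x (Perm.trans p q) = trans (countBelow-↭ x p) (countBelow-↭ x q)

countBelow-map-suc : ∀ k L → countBelow (suc k) (map suc L) ≡ countBelow k L
countBelow-map-suc k [] = refl
countBelow-map-suc k (y ∷ L) with y <ᵇ k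
... | true  = cong suc (countBelow-map-suc k L)
... | false = countBelow-map-suc k L

countBelow-zero : ∀ L → countBelow 0 L ≡ 0
countBelow-zero [] = refl
countBelow-zero (_ ∷ L) = countBelow-zero L

countBelow-upTo : ∀ n k → k ≤ n → countBelow k (upTo n) ≡ k
countBelow-upTo n zero _ = countBelow-zero (upTo n)
countBelow-upTo (suc n) (suc k) (s≤s k≤n) rewrite sym (Listₚ.map-applyUpTo id suc n) =
  cong suc (trans (countBelow-map-suc k (upTo n)) (countBelow-upTo n k k≤n))

std-perm : ∀ π → IsPerm π → std π ≡ π
std-perm π perm = trans (Listₚ.map-cong-local (All.tabulate rank-is-value)) (Listₚ.map-id π)
  where
  n = length π
  rank-is-value : ∀ {x} → x ∈ π → rank π x ≡ x
  rank-is-value x∈π with ∈-map⁻ suc (∈-resp-↭ perm x∈π)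
  ... | k , k∈ , refl = cong suc (begin
    countBelow (suc k) π                  ≡⟨ countBelow-↭ (suc k) perm ⟩
    countBelow (suc k) (map suc (upTo n)) ≡⟨ countBelow-map-suc k (upTo n) ⟩
    countBelow k (upTo n)                 ≡⟨ countBelow-upTo n k (ℕₚ.<⇒≤ (∈-upTo⁻ k∈)) ⟩
    k                                     ∎)
    where open ≡-Reasoning

theorem3p1 : (π : List ℕ) → IsPerm π → HasUpAdjacency π → HasDownAdjacency π
    → μ (1 ∷ []) π ≡ 0ℤ
theorem3p1 π perm up down =
  μ₁-opposing-adjacencies (suc (length π)) π ℕₚ.≤-refl (Unique-perm perm) (std-perm π perm) up down
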